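{- Let $A$ be an alphabet with $m\ge2$ letters, $k\ge1$, and let $x_t$, $t\in A^k$, be $m^k$ unknowns. The system of linear equations \[\sum_{a\in A}x_{as}=\sum_{a\in A}x_{sa}\qquad(s\in A^{k-1})\] is not linearly independent, but every proper subsystem of it is linearly independent. Moreover, adding the equation $\sum_{t\in A^k}x_t=0$ to any such proper (independent) subsystem yields a linearly independent system. -}

module Defs where

open import Data.Nat using (ℕ; zero; suc)
open import Data.Fin using (Fin)
open import Data.Vec using (Vec; []; _∷_; _∷ʳ_)
open import Data.List using (List; [_]; _∷_; map; concatMap; allFin; foldr; filterᵇ)
open import Data.List.Membership.Propositional using (_∈_)
open import Data.Maybe using (Maybe; just; nothing)
open import Data.Bool using (Bool)
open import Data.Rational using (ℚ; 0ℚ; _+_; _-_; _*_)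
open import Relation.Binary.PropositionalEquality using (_≡_)

allWords : (m n : ℕ) → List (Vec (Fin m) n)
allWords m zero    = [ [] ]
allWords m (suc n) = concatMap (λ a → map (a ∷_) (allWords m n)) (allFin m)

sumℚ : List ℚ → ℚ
sumℚ = foldr _+_ 0ℚ

-- An assignment of the unknowns x_t, t ∈ A^(n+1).
Assignment : (m n : ℕ) → Set
Assignment m n = Vec (Fin m) (suc n) → ℚ

eqForm : (m n : ℕ) → Vec (Fin m) n → Assignment m n → ℚ
eqForm m n s x = sumℚ (map (λ a → x (a ∷ s)) (allFin m))
               - sumℚ (map (λ a → x (s ∷ʳ a)) (allFin m))

totalForm : (m n : ℕ) → Assignment m n → ℚ
totalForm m n x = sumℚ (map x (allWords m (suc n)))

-- Linear independence (over ℚ) of the family of linear forms (f j)_{j ∈ I},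
-- I a duplicate-free list of indices: the only linear combination that is
-- the zero form is the trivial one.
LinIndep : {J : Set} (m n : ℕ) → (J → Assignment m n → ℚ) → List J → Set
LinIndep m n f I =
  (c : _ → ℚ) →
  ((x : Assignment m n) → sumℚ (map (λ j → c j * f j x) I) ≡ 0ℚ) →
  ∀ j → j ∈ I → c j ≡ 0ℚ

subsystem : (m n : ℕ) → (Vec (Fin m) n → Bool) → List (Vec (Fin m) n)
subsystem m n P = filterᵇ P (allWords m n)

extForm : (m n : ℕ) → Maybe (Vec (Fin m) n) → Assignment m n → ℚ
extForm m n nothing  = totalForm m n
extForm m n (just s) = eqForm m n s

-- A combination  c₀ · Σₜ xₜ + Σₛ dₛ · (Σₐ x_{as} − Σₐ x_{sa})  equals  Σₜ xₜ eₜ  with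
-- eₜ = c₀ + d(tail t) − d(init t).  If it is the zero form, substituting x = e gives
-- Σₜ eₜ² = 0, so e = 0.  At a constant word tail and init agree, whence c₀ = 0; then d is
-- invariant under  tail t ↦ init t, and since the de Bruijn graph is connected, d is constant.
-- A proper subsystem has a coefficient d_{s₀} = 0, so all coefficients vanish; the full
-- system carries the relation d = 1.
module Submission where

open import Defs
open import Data.Nat using (ℕ; zero; suc; _≤_)
open import Data.Fin as Fin using (Fin)
open import Data.Vec using (Vec; []; _∷_; _∷ʳ_; tail; init; replicate)
open import Data.Vec.Properties using (init-∷ʳ)
open import Data.Bool using (Bool; true; false; if_then_else_; T?)
open import Data.Bool.Properties using (T-≡)
open import Data.List using (List; []; _∷_; map; _++_; concatMap; allFin; filterᵇ)
open import Data.List.Properties using (map-++; map-∘; map-cong)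
open import Data.List.Membership.Propositional using (_∈_; lose)
open import Data.List.Membership.Propositional.Properties
  using (∈-map⁺; ∈-map⁻; ∈-concatMap⁺; ∈-allFin; ∈-filter⁻)
open import Data.List.Relation.Unary.Any using (here; there)
open import Data.Maybe using (nothing; just)
open import Data.Product using (_×_; ∃; _,_; proj₁; proj₂)
open import Data.Empty using (⊥-elim)
open import Function using (Equivalence; _∘_)
open import Relation.Nullary using (¬_; yes; no)
open import Relation.Binary.PropositionalEquality
open import Relation.Binary.Definitions using (tri<; tri≈; tri>)
open import Data.Rational as ℚ using (ℚ; 0ℚ; 1ℚ; _+_; _-_; _*_; positive; negative)
open import Data.Rational.Properties
  using (_≟_; <-cmp; ≤-refl; <⇒≤; <-≤-trans; <-irrefl; +-mono-≤; +-identityˡ; +-identityʳ;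
         *-zeroˡ; *-zeroʳ; *-comm; *-distribˡ-+; neg*neg⇒pos; pos*pos⇒pos; positive⁻¹; 1≢0;
         +-0-group)
open import Algebra.Properties.Group +-0-group using (x∙y⁻¹≈ε⇒x≈y)
open import Data.Rational.Solver using (module +-*-Solver)
open +-*-Solver using (solve; _:+_; _:*_; _:-_; _:=_)
open ≡-Reasoning

p≢0⇒p*p>0 : ∀ p → p ≢ 0ℚ → 0ℚ ℚ.< p * p
p≢0⇒p*p>0 p p≢0 with <-cmp p 0ℚ
... | tri< p<0 _ _ = positive⁻¹ (p * p) {{neg*neg⇒pos p {{negative p<0}} p {{negative p<0}}}}
... | tri≈ _ p≡0 _ = ⊥-elim (p≢0 p≡0)
... | tri> _ _ p>0 = positive⁻¹ (p * p) {{pos*pos⇒pos p {{positive p>0}} p {{positive p>0}}}}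

p*p≥0 : ∀ p → 0ℚ ℚ.≤ p * p
p*p≥0 p with p ≟ 0ℚ
... | yes refl = ≤-refl
... | no p≢0  = <⇒≤ (p≢0⇒p*p>0 p p≢0)

module _ {A : Set} where

  ∑ : List A → (A → ℚ) → ℚ
  ∑ L f = sumℚ (map f L)

  ∑-cong : ∀ (L : List A) {f g : A → ℚ} → (∀ a → f a ≡ g a) → ∑ L f ≡ ∑ L g
  ∑-cong L f≗g = cong sumℚ (map-cong f≗g L)

  ∑-zero : ∀ (L : List A) → ∑ L (λ _ → 0ℚ) ≡ 0ℚ
  ∑-zero []      = refl
  ∑-zero (_ ∷ L) = cong (0ℚ +_) (∑-zero L)

  ∑-+ : ∀ (L : List A) (f g : A → ℚ) → ∑ L (λ a → f a + g a) ≡ ∑ L f + ∑ L g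
  ∑-+ []      f g = refl
  ∑-+ (a ∷ L) f g = trans (cong (f a + g a +_) (∑-+ L f g))
    (solve 4 (λ p q r s → (p :+ q) :+ (r :+ s) := (p :+ r) :+ (q :+ s)) refl (f a) (g a) (∑ L f) (∑ L g))

  ∑-- : ∀ (L : List A) (f g : A → ℚ) → ∑ L (λ a → f a - g a) ≡ ∑ L f - ∑ L g
  ∑-- []      f g = refl
  ∑-- (a ∷ L) f g = trans (cong (f a - g a +_) (∑-- L f g))
    (solve 4 (λ p q r s → (p :- q) :+ (r :- s) := (p :+ r) :- (q :+ s)) refl (f a) (g a) (∑ L f) (∑ L g))

  *-distribˡ-∑ : ∀ (L : List A) c (f : A → ℚ) → c * ∑ L f ≡ ∑ L (λ a → c * f a)
  *-distribˡ-∑ []      c f = *-zeroʳ c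
  *-distribˡ-∑ (a ∷ L) c f = trans (*-distribˡ-+ c (f a) (∑ L f)) (cong (c * f a +_) (*-distribˡ-∑ L c f))

  ∑-filterᵇ-* : ∀ (P : A → Bool) (L : List A) (c f : A → ℚ) →
                ∑ (filterᵇ P L) (λ a → c a * f a) ≡ ∑ L (λ a → (if P a then c a else 0ℚ) * f a)
  ∑-filterᵇ-* P []      c f = refl
  ∑-filterᵇ-* P (a ∷ L) c f with P a
  ... | true  = cong (c a * f a +_) (∑-filterᵇ-* P L c f)
  ... | false = trans (∑-filterᵇ-* P L c f) (trans (sym (+-identityˡ _)) (cong (_+ _) (sym (*-zeroˡ (f a)))))

  ∑-squares≥0 : ∀ (L : List A) (g : A → ℚ) → 0ℚ ℚ.≤ ∑ L (λ a → g a * g a)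
  ∑-squares≥0 []      g = ≤-refl
  ∑-squares≥0 (a ∷ L) g = +-mono-≤ (p*p≥0 (g a)) (∑-squares≥0 L g)

  square≤∑-squares : ∀ (L : List A) (g : A → ℚ) {a} → a ∈ L → g a * g a ℚ.≤ ∑ L (λ b → g b * g b)
  square≤∑-squares (a ∷ L) g (here refl) =
    subst (ℚ._≤ ∑ (a ∷ L) (λ b → g b * g b)) (+-identityʳ (g a * g a)) (+-mono-≤ (≤-refl {g a * g a}) (∑-squares≥0 L g))
  square≤∑-squares (b ∷ L) g (there a∈L) =
    subst (ℚ._≤ ∑ (b ∷ L) (λ c → g c * g c)) (+-identityˡ _) (+-mono-≤ (p*p≥0 (g b)) (square≤∑-squares L g a∈L))

  ∑-squares≡0⇒zero : ∀ (L : List A) (g : A → ℚ) → ∑ L (λ a → g a * g a) ≡ 0ℚ → ∀ {a} → a ∈ L → g a ≡ 0ℚ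
  ∑-squares≡0⇒zero L g ∑≡0 {a} a∈L with g a ≟ 0ℚ
  ... | yes ga≡0 = ga≡0
  ... | no  ga≢0 = ⊥-elim (<-irrefl refl
                     (<-≤-trans (p≢0⇒p*p>0 (g a) ga≢0) (subst (_ ℚ.≤_) ∑≡0 (square≤∑-squares L g a∈L))))

  -- Test the form against its own coefficient vector.
  pairing-vanishes⇒zero : ∀ (L : List A) → (∀ a → a ∈ L) → (g : A → ℚ) →
                          (∀ x → ∑ L (λ a → x a * g a) ≡ 0ℚ) → ∀ a → g a ≡ 0ℚ
  pairing-vanishes⇒zero L complete g vanishes a = ∑-squares≡0⇒zero L g (vanishes g) (complete a)

∑-comm : ∀ {A B : Set} (L : List A) (M : List B) (F : A → B → ℚ) →
         ∑ L (λ a → ∑ M (F a)) ≡ ∑ M (λ b → ∑ L (λ a → F a b))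
∑-comm []      M F = sym (∑-zero M)
∑-comm (a ∷ L) M F = trans (cong (∑ M (F a) +_) (∑-comm L M F)) (sym (∑-+ M (F a) _))

∑-concatMap : ∀ {A B : Set} (g : A → List B) (L : List A) (f : B → ℚ) →
              ∑ (concatMap g L) f ≡ ∑ L (λ a → ∑ (g a) f)
∑-concatMap g []      f = refl
∑-concatMap g (a ∷ L) f = begin
  sumℚ (map f (g a ++ concatMap g L))          ≡⟨ cong sumℚ (map-++ f (g a) (concatMap g L)) ⟩
  sumℚ (map f (g a) ++ map f (concatMap g L))  ≡⟨ sumℚ-++ (map f (g a)) _ ⟩
  ∑ (g a) f + ∑ (concatMap g L) f              ≡⟨ cong (∑ (g a) f +_) (∑-concatMap g L f) ⟩
  ∑ (g a) f + ∑ L (λ a → ∑ (g a) f)            ∎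
  where
  sumℚ-++ : ∀ xs ys → sumℚ (xs ++ ys) ≡ sumℚ xs + sumℚ ys
  sumℚ-++ []       ys = sym (+-identityˡ _)
  sumℚ-++ (x ∷ xs) ys = trans (cong (x +_) (sumℚ-++ xs ys))
    (solve 3 (λ p q r → p :+ (q :+ r) := (p :+ q) :+ r) refl x (sumℚ xs) (sumℚ ys))

module _ {A B : Set} where

  shift-invariant⇒constant : ∀ n (d : Vec A n → B) → (∀ t → d (tail t) ≡ d (init t)) →
                             ∀ s s′ → d s ≡ d s′
  shift-invariant⇒constant zero    d _   [] [] = refl
  shift-invariant⇒constant (suc k) d inv (a ∷ u) (a′ ∷ u′) =
    trans (shift-invariant⇒constant k (λ v → d (a ∷ v)) inv-a u u′) (head-irrelevant a a′ u′)
    where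
    ∷≡∷ʳ : ∀ a w b → d (a ∷ w) ≡ d (w ∷ʳ b)
    ∷≡∷ʳ a w b = trans (cong (λ v → d (a ∷ v)) (sym (init-∷ʳ b w))) (sym (inv (a ∷ (w ∷ʳ b))))
    head-irrelevant : ∀ a a′ w → d (a ∷ w) ≡ d (a′ ∷ w)
    head-irrelevant a a′ w = trans (∷≡∷ʳ a w a) (sym (∷≡∷ʳ a′ w a))
    inv-a : ∀ t → d (a ∷ tail t) ≡ d (a ∷ init t)
    inv-a (c ∷ w) = trans (head-irrelevant a c w) (inv (a ∷ c ∷ w))

init-replicate : ∀ {A : Set} n (a : A) → init (replicate (suc n) a) ≡ replicate n a
init-replicate zero    a = refl
init-replicate (suc n) a = cong (a ∷_) (init-replicate n a)

module _ (m : ℕ) where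

  ∈-allWords : ∀ n (t : Vec (Fin m) n) → t ∈ allWords m n
  ∈-allWords zero    []      = here refl
  ∈-allWords (suc n) (a ∷ u) = ∈-concatMap⁺ (λ b → map (b ∷_) (allWords m n)) (lose (∈-allFin a) (∈-map⁺ (a ∷_) (∈-allWords n u)))

  ∑-allWords-suc : ∀ n (f : Vec (Fin m) (suc n) → ℚ) →
                   ∑ (allWords m (suc n)) f ≡ ∑ (allFin m) (λ a → ∑ (allWords m n) (λ s → f (a ∷ s)))
  ∑-allWords-suc n f = trans (∑-concatMap (λ a → map (a ∷_) (allWords m n)) (allFin m) f)
    (∑-cong (allFin m) (λ a → cong sumℚ (sym (map-∘ (allWords m n)))))

  ∑-allWords-∷ : ∀ n (F : Vec (Fin m) (suc n) → ℚ) →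
                 ∑ (allWords m n) (λ s → ∑ (allFin m) (λ a → F (a ∷ s))) ≡ ∑ (allWords m (suc n)) F
  ∑-allWords-∷ n F = trans (∑-comm (allWords m n) (allFin m) (λ s a → F (a ∷ s))) (sym (∑-allWords-suc n F))

  ∑-allWords-∷ʳ : ∀ n (F : Vec (Fin m) (suc n) → ℚ) →
                  ∑ (allWords m n) (λ s → ∑ (allFin m) (λ a → F (s ∷ʳ a))) ≡ ∑ (allWords m (suc n)) F
  ∑-allWords-∷ʳ zero    F = trans (+-identityʳ _)
    (trans (∑-cong (allFin m) (λ a → sym (+-identityʳ (F (a ∷ []))))) (sym (∑-allWords-suc zero F)))
  ∑-allWords-∷ʳ (suc n) F = begin
    ∑ (allWords m (suc n)) (λ s → ∑ (allFin m) (λ a → F (s ∷ʳ a)))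
      ≡⟨ ∑-allWords-suc n _ ⟩
    ∑ (allFin m) (λ b → ∑ (allWords m n) (λ s → ∑ (allFin m) (λ a → F (b ∷ (s ∷ʳ a)))))
      ≡⟨ ∑-cong (allFin m) (λ b → ∑-allWords-∷ʳ n (λ t → F (b ∷ t))) ⟩
    ∑ (allFin m) (λ b → ∑ (allWords m (suc n)) (λ t → F (b ∷ t)))
      ≡⟨ sym (∑-allWords-suc (suc n) F) ⟩
    ∑ (allWords m (suc (suc n))) F
      ∎

  -- Transposing the equations: x_t enters equation tail t positively and equation init t negatively.
  eqForm-transpose : ∀ n (d : Vec (Fin m) n → ℚ) (x : Assignment m n) →
                     ∑ (allWords m n) (λ s → d s * eqForm m n s x)
                     ≡ ∑ (allWords m (suc n)) (λ t → x t * (d (tail t) - d (init t)))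
  eqForm-transpose n d x = begin
    ∑ (allWords m n) (λ s → d s * eqForm m n s x)
      ≡⟨ ∑-cong (allWords m n) (λ s → *-distribˡ-- (d s) (in-sum s) (out-sum s)) ⟩
    ∑ (allWords m n) (λ s → d s * in-sum s - d s * out-sum s)
      ≡⟨ ∑-- (allWords m n) _ _ ⟩
    ∑ (allWords m n) (λ s → d s * in-sum s) - ∑ (allWords m n) (λ s → d s * out-sum s)
      ≡⟨ cong₂ _-_ incoming outgoing ⟩
    ∑ (allWords m (suc n)) (λ t → x t * d (tail t)) - ∑ (allWords m (suc n)) (λ t → x t * d (init t))
      ≡⟨ sym (∑-- (allWords m (suc n)) _ _) ⟩
    ∑ (allWords m (suc n)) (λ t → x t * d (tail t) - x t * d (init t))
      ≡⟨ ∑-cong (allWords m (suc n)) (λ t → sym (*-distribˡ-- (x t) (d (tail t)) (d (init t)))) ⟩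
    ∑ (allWords m (suc n)) (λ t → x t * (d (tail t) - d (init t)))
      ∎
    where
    in-sum out-sum : Vec (Fin m) n → ℚ
    in-sum  s = ∑ (allFin m) (λ a → x (a ∷ s))
    out-sum s = ∑ (allFin m) (λ a → x (s ∷ʳ a))
    *-distribˡ-- : ∀ p q r → p * (q - r) ≡ p * q - p * r
    *-distribˡ-- = solve 3 (λ p q r → p :* (q :- r) := p :* q :- p :* r) refl
    incoming : ∑ (allWords m n) (λ s → d s * in-sum s) ≡ ∑ (allWords m (suc n)) (λ t → x t * d (tail t))
    incoming = trans
      (∑-cong (allWords m n) (λ s → trans (*-distribˡ-∑ (allFin m) (d s) _)
                                         (∑-cong (allFin m) (λ a → *-comm (d s) (x (a ∷ s))))))
      (∑-allWords-∷ n (λ t → x t * d (tail t)))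
    outgoing : ∑ (allWords m n) (λ s → d s * out-sum s) ≡ ∑ (allWords m (suc n)) (λ t → x t * d (init t))
    outgoing = trans
      (∑-cong (allWords m n) (λ s → trans (*-distribˡ-∑ (allFin m) (d s) _)
        (∑-cong (allFin m) (λ a → trans (*-comm (d s) (x (s ∷ʳ a)))
                                         (cong (λ v → x (s ∷ʳ a) * d v) (sym (init-∷ʳ a s)))))))
      (∑-allWords-∷ʳ n (λ t → x t * d (init t)))

  combination-as-pairing : ∀ n c₀ (d : Vec (Fin m) n → ℚ) (x : Assignment m n) →
    c₀ * totalForm m n x + ∑ (allWords m n) (λ s → d s * eqForm m n s x)
    ≡ ∑ (allWords m (suc n)) (λ t → x t * (c₀ + (d (tail t) - d (init t))))
  combination-as-pairing n c₀ d x = begin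
    c₀ * totalForm m n x + ∑ (allWords m n) (λ s → d s * eqForm m n s x)
      ≡⟨ cong₂ _+_ (*-distribˡ-∑ (allWords m (suc n)) c₀ x) (eqForm-transpose n d x) ⟩
    ∑ (allWords m (suc n)) (λ t → c₀ * x t) + ∑ (allWords m (suc n)) (λ t → x t * (d (tail t) - d (init t)))
      ≡⟨ sym (∑-+ (allWords m (suc n)) _ _) ⟩
    ∑ (allWords m (suc n)) (λ t → c₀ * x t + x t * (d (tail t) - d (init t)))
      ≡⟨ ∑-cong (allWords m (suc n)) (λ t →
           solve 3 (λ c y e → c :* y :+ y :* e := y :* (c :+ e)) refl c₀ (x t) (d (tail t) - d (init t))) ⟩
    ∑ (allWords m (suc n)) (λ t → x t * (c₀ + (d (tail t) - d (init t))))
      ∎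

  vanishing-combination⇒trivial : ∀ n → Fin m → ∀ c₀ (d : Vec (Fin m) n → ℚ) →
    (∀ x → c₀ * totalForm m n x + ∑ (allWords m n) (λ s → d s * eqForm m n s x) ≡ 0ℚ) →
    c₀ ≡ 0ℚ × (∀ s s′ → d s ≡ d s′)
  vanishing-combination⇒trivial n a c₀ d vanishes = c₀≡0 , shift-invariant⇒constant n d shift-invariant
    where
    e : Vec (Fin m) (suc n) → ℚ
    e t = c₀ + (d (tail t) - d (init t))
    e≡0 : ∀ t → e t ≡ 0ℚ
    e≡0 = pairing-vanishes⇒zero (allWords m (suc n)) (∈-allWords (suc n)) e
            (λ x → trans (sym (combination-as-pairing n c₀ d x)) (vanishes x))
    c₀≡0 : c₀ ≡ 0ℚ
    c₀≡0 = begin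
      c₀                                        ≡⟨ solve 2 (λ c p → c := c :+ (p :- p)) refl c₀ (d (replicate n a)) ⟩
      c₀ + (d (replicate n a) - d (replicate n a)) ≡⟨ cong (λ w → c₀ + (d (replicate n a) - d w)) (sym (init-replicate n a)) ⟩
      e (replicate (suc n) a)                   ≡⟨ e≡0 (replicate (suc n) a) ⟩
      0ℚ                                        ∎
    shift-invariant : ∀ t → d (tail t) ≡ d (init t)
    shift-invariant t = x∙y⁻¹≈ε⇒x≈y _ _ (begin
      d (tail t) - d (init t)       ≡⟨ sym (+-identityˡ _) ⟩
      0ℚ + (d (tail t) - d (init t)) ≡⟨ cong (λ c → c + (d (tail t) - d (init t))) (sym c₀≡0) ⟩
      e t                           ≡⟨ e≡0 t ⟩
      0ℚ                            ∎)

  vanishing-subcombination⇒trivial : ∀ n → Fin m → (P : Vec (Fin m) n → Bool) → ∀ s₀ → P s₀ ≡ false →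
    ∀ c₀ (c : Vec (Fin m) n → ℚ) →
    (∀ x → c₀ * totalForm m n x + ∑ (subsystem m n P) (λ s → c s * eqForm m n s x) ≡ 0ℚ) →
    c₀ ≡ 0ℚ × (∀ s → s ∈ subsystem m n P → c s ≡ 0ℚ)
  vanishing-subcombination⇒trivial n a P s₀ Ps₀≡false c₀ c vanishes = proj₁ trivial , c≡0
    where
    d : Vec (Fin m) n → ℚ
    d s = if P s then c s else 0ℚ
    trivial : c₀ ≡ 0ℚ × (∀ s s′ → d s ≡ d s′)
    trivial = vanishing-combination⇒trivial n a c₀ d λ x →
      trans (cong (c₀ * totalForm m n x +_) (sym (∑-filterᵇ-* P (allWords m n) c (λ s → eqForm m n s x))))
            (vanishes x)
    c≡0 : ∀ s → s ∈ subsystem m n P → c s ≡ 0ℚ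
    c≡0 s s∈ = begin
      c s  ≡⟨ cong (λ b → if b then c s else 0ℚ) (sym (Equivalence.to T-≡ (proj₂ (∈-filter⁻ (T? ∘ P) {xs = allWords m n} s∈)))) ⟩
      d s  ≡⟨ proj₂ trivial s s₀ ⟩
      d s₀ ≡⟨ cong (λ b → if b then c s₀ else 0ℚ) Ps₀≡false ⟩
      0ℚ   ∎

  eqForms-dependent : ∀ n → Fin m → ¬ LinIndep m n (eqForm m n) (allWords m n)
  eqForms-dependent n a independent =
    1≢0 (independent (λ _ → 1ℚ) all-ones-vanishes (replicate n a) (∈-allWords n _))
    where
    all-ones-vanishes : ∀ x → ∑ (allWords m n) (λ s → 1ℚ * eqForm m n s x) ≡ 0ℚ
    all-ones-vanishes x = begin
      ∑ (allWords m n) (λ s → 1ℚ * eqForm m n s x)          ≡⟨ eqForm-transpose n (λ _ → 1ℚ) x ⟩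
      ∑ (allWords m (suc n)) (λ t → x t * (1ℚ - 1ℚ))        ≡⟨ ∑-cong (allWords m (suc n)) (λ t → *-zeroʳ (x t)) ⟩
      ∑ (allWords m (suc n)) (λ _ → 0ℚ)                    ≡⟨ ∑-zero (allWords m (suc n)) ⟩
      0ℚ                                                   ∎

  proper-subsystem-independent : ∀ n → Fin m → (P : Vec (Fin m) n → Bool) → ∀ s₀ → P s₀ ≡ false →
                                 LinIndep m n (eqForm m n) (subsystem m n P)
  proper-subsystem-independent n a P s₀ Ps₀≡false c vanishes =
    proj₂ (vanishing-subcombination⇒trivial n a P s₀ Ps₀≡false 0ℚ c λ x →
      trans (cong (_+ ∑ (subsystem m n P) (λ s → c s * eqForm m n s x)) (*-zeroˡ (totalForm m n x)))
            (trans (+-identityˡ _) (vanishes x)))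

  proper-subsystem-with-total-independent : ∀ n → Fin m → (P : Vec (Fin m) n → Bool) → ∀ s₀ → P s₀ ≡ false →
                                            LinIndep m n (extForm m n) (nothing ∷ map just (subsystem m n P))
  proper-subsystem-with-total-independent n a P s₀ Ps₀≡false c vanishes = c≡0
    where
    trivial : c nothing ≡ 0ℚ × (∀ s → s ∈ subsystem m n P → c (just s) ≡ 0ℚ)
    trivial = vanishing-subcombination⇒trivial n a P s₀ Ps₀≡false (c nothing) (c ∘ just) λ x →
      trans (cong (c nothing * totalForm m n x +_) (cong sumℚ (map-∘ (subsystem m n P)))) (vanishes x)
    c≡0 : ∀ j → j ∈ nothing ∷ map just (subsystem m n P) → c j ≡ 0ℚ
    c≡0 _ (here refl) = proj₁ trivial
    c≡0 _ (there j∈) with ∈-map⁻ just j∈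
    ... | s , s∈ , refl = proj₂ trivial s s∈

lemma13 : (m n : ℕ) → 2 ≤ m →
          ¬ LinIndep m n (eqForm m n) (allWords m n)
          × ((P : Vec (Fin m) n → Bool) → ∃ (λ s → P s ≡ false) →
               LinIndep m n (eqForm m n) (subsystem m n P)
               × LinIndep m n (extForm m n) (nothing ∷ map just (subsystem m n P)))
lemma13 (suc m) n _ =
  eqForms-dependent (suc m) n Fin.zero ,
  λ { P (s₀ , Ps₀≡false) → proper-subsystem-independent (suc m) n Fin.zero P s₀ Ps₀≡false
                         , proper-subsystem-with-total-independent (suc m) n Fin.zero P s₀ Ps₀≡false }
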